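{- Let $k\ge 1$ and let $(P_{2k},\sigma)$ be a signed path $v_1v_2\cdots v_{2k}$ with a list assignment $L$ satisfying one of the following: (1) $L(v_1)$ is a paired $3$-set, $L(v_{2k})$ is a one-sided $4$-set, and for $i\in\{2,\dots,2k-1\}$, $L(v_i)$ contains a neighbored $5$-set if $i$ is odd and $|L(v_i)|\ge 10$ if $i$ is even; (2) $L(v_1)$ is a one-sided $4$-set, $L(v_{2k})$ is a paired $3$-set, and for $i\in\{2,\dots,2k-1\}$, $L(v_i)$ contains a neighbored $5$-set if $i$ is odd and $|L(v_i)|\ge 10$ if $i$ is even. Then $(P_{2k},\sigma)$ is $L$-colorable.
   Context: A signed path carries a signature $\sigma:E\to\{+,-\}$. Let $C=\{i^+,i^-:1\le i\le 6\}$ be the vertex set of ${\rm DSG}(K_6,M)$ with signature $m^*$: for $i\ne j$ and $\alpha\in\{+,-\}$, $i^\alpha j^\alpha$ is an edge, negative if $\{i,j\}\in\{\{1,2\},\{3,4\},\{5,6\}\}$ and positive otherwise; $i^\alpha j^{ -\alpha}$ is an edge, positive if $\{i,j\}\in\{\{1,2\},\{3,4\},\{5,6\}\}$ and negative otherwise; $i^+,i^-$ are non-adjacent. $C^\pm=\{i^\pm\}$. The pair of $(2l-1)^\alpha$ is $(2l)^\alpha$ and vice versa; a layer is $\{(2l-1)^+,(2l)^+,(2l-1)^-,(2l)^-\}$, $l=1,2,3$. A set $L\subseteq C$ is paired if all but at most one of its elements have their pair in $L$; a paired $n$-set is a paired set of size $n$. A paired set is layered if no three of its elements lie in one layer; a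 one-sided $n$-set is a layered set of size $n$ contained in $C^+$ or in $C^-$. A neighbored $5$-set is a layered $5$-set consisting of two pairs in one of $C^+,C^-$ and one element of the other. A list assignment $L$ gives each vertex $v$ a set $L(v)\subseteq C$; an $L$-coloring is a map $\phi$ with $\phi(v)\in L(v)$ such that each edge $uv$ maps to an edge $\phi(u)\phi(v)$ with $m^*(\phi(u)\phi(v))=\sigma(uv)$. -}

module Defs where

open import Data.Nat using (ℕ; zero; suc; _+_; _*_; _∸_; _≤_; _<_; _%_)
open import Data.Fin using (Fin; zero; suc)
open import Data.Bool using (Bool; true; false; _∧_; not; if_then_else_)
open import Data.List using (List; []; _∷_; _++_; map)
open import Data.Product using (_×_; _,_; proj₁; proj₂; Σ; ∃)
open import Data.Sum using (_⊎_)
open import Relation.Binary.PropositionalEquality using (_≡_; _≢_)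
open import Data.Fin.Properties using () renaming (_≟_ to _≟F_)
open import Relation.Nullary.Decidable using (⌊_⌋)

data Sg : Set where
  ⊕ ⊖ : Sg

negSg : Sg → Sg
negSg ⊕ = ⊖
negSg ⊖ = ⊕

_==Sg_ : Sg → Sg → Bool
⊕ ==Sg ⊕ = true
⊖ ==Sg ⊖ = true
_ ==Sg _ = false

-- Colours: C = { i^α : 1 ≤ i ≤ 6, α ∈ {+,-} }.
-- Index i ∈ Fin 6 encodes the label i+1: 0↔1, 1↔2, 2↔3, 3↔4, 4↔5, 5↔6.
C : Set
C = Fin 6 × Sg

idx : C → Fin 6
idx = proj₁

sgn : C → Sg
sgn = proj₂

pairIdx : Fin 6 → Fin 6
pairIdx zero = suc zero
pairIdx (suc zero) = zero
pairIdx (suc (suc zero)) = suc (suc (suc zero))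
pairIdx (suc (suc (suc zero))) = suc (suc zero)
pairIdx (suc (suc (suc (suc zero)))) = suc (suc (suc (suc (suc zero))))
pairIdx (suc (suc (suc (suc (suc zero))))) = suc (suc (suc (suc zero)))

pairC : C → C
pairC (i , a) = (pairIdx i , a)

layerIdx : Fin 6 → Fin 3
layerIdx zero = zero
layerIdx (suc zero) = zero
layerIdx (suc (suc zero)) = suc zero
layerIdx (suc (suc (suc zero))) = suc zero
layerIdx (suc (suc (suc (suc zero)))) = suc (suc zero)
layerIdx (suc (suc (suc (suc (suc zero))))) = suc (suc zero)

layer : C → Fin 3
layer c = layerIdx (idx c)

-- {i,j} ∈ {{1,2},{3,4},{5,6}}  (for i ≠ j this means: same layer)
isPairIdx : Fin 6 → Fin 6 → Bool
isPairIdx zero (suc zero) = true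
isPairIdx (suc zero) zero = true
isPairIdx (suc (suc zero)) (suc (suc (suc zero))) = true
isPairIdx (suc (suc (suc zero))) (suc (suc zero)) = true
isPairIdx (suc (suc (suc (suc zero)))) (suc (suc (suc (suc (suc zero))))) = true
isPairIdx (suc (suc (suc (suc (suc zero))))) (suc (suc (suc (suc zero)))) = true
isPairIdx _ _ = false

-- Edges of DSG(K_6, M): i^α j^β adjacent iff i ≠ j
Adjacent : C → C → Set
Adjacent (i , a) (j , b) = i ≢ j

-- Signature m* (meaningful on edges, i.e. when i ≠ j):
--   i^α j^α  : negative if {i,j} ∈ M, positive otherwise
--   i^α j^-α : positive if {i,j} ∈ M, negative otherwise
mstar : C → C → Sg
mstar (i , a) (j , b) =
  if a ==Sg b
    then (if isPairIdx i j then ⊖ else ⊕)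
    else (if isPairIdx i j then ⊕ else ⊖)

CSet : Set
CSet = C → Bool

_∈C_ : C → CSet → Set
c ∈C S = S c ≡ true

_⊆C_ : CSet → CSet → Set
S ⊆C T = ∀ c → c ∈C S → c ∈C T

allFin6 : List (Fin 6)
allFin6 = zero ∷ suc zero ∷ suc (suc zero) ∷ suc (suc (suc zero))
  ∷ suc (suc (suc (suc zero))) ∷ suc (suc (suc (suc (suc zero)))) ∷ []

allC : List C
allC = map (λ i → (i , ⊕)) allFin6 ++ map (λ i → (i , ⊖)) allFin6

countL : (C → Bool) → List C → ℕ
countL p [] = 0
countL p (c ∷ cs) = (if p c then 1 else 0) + countL p cs

count : (C → Bool) → ℕ
count p = countL p allC

size : CSet → ℕ
size S = count S

_==F3_ : Fin 3 → Fin 3 → Bool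
x ==F3 y = ⌊ x ≟F y ⌋

Paired : CSet → Set
Paired S = count (λ c → S c ∧ not (S (pairC c))) ≤ 1

Layered : CSet → Set
Layered S = Paired S × (∀ (l : Fin 3) → count (λ c → S c ∧ (layer c ==F3 l)) ≤ 2)

PairedSet : ℕ → CSet → Set
PairedSet n S = Paired S × size S ≡ n

OneSided : ℕ → CSet → Set
OneSided n S = Layered S × size S ≡ n × Σ Sg (λ a → ∀ c → c ∈C S → sgn c ≡ a)

Neighbored : CSet → Set
Neighbored S = Layered S × size S ≡ 5 × Σ Sg (λ a →
    count (λ c → S c ∧ (sgn c ==Sg a)) ≡ 4
  × count (λ c → S c ∧ (sgn c ==Sg negSg a)) ≡ 1
  × (∀ c → c ∈C S → sgn c ≡ a → pairC c ∈C S))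

ContainsNeighbored : CSet → Set
ContainsNeighbored L = Σ CSet (λ S → S ⊆C L × Neighbored S)

-- Signed path v_1 v_2 ⋯ v_n: vertex v_i is index i (1 ≤ i ≤ n);
-- σ i is the sign of the edge v_i v_{i+1} (1 ≤ i < n).
-- L i is the list of v_i. An L-colouring φ:
IsLColoring : ℕ → (ℕ → Sg) → (ℕ → CSet) → (ℕ → C) → Set
IsLColoring n σ L φ =
    (∀ i → 1 ≤ i → i ≤ n → φ i ∈C L i)
  × (∀ i → 1 ≤ i → i < n → Adjacent (φ i) (φ (suc i)) × mstar (φ i) (φ (suc i)) ≡ σ i)

LColorable : ℕ → (ℕ → Sg) → (ℕ → CSet) → Set
LColorable n σ L = Σ (ℕ → C) (λ φ → IsLColoring n σ L φ)

InnerCond : ℕ → (ℕ → CSet) → Set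
InnerCond k L = ∀ i → 2 ≤ i → i ≤ 2 * k ∸ 1 →
  (i % 2 ≡ 1 → ContainsNeighbored (L i)) × (i % 2 ≡ 0 → 10 ≤ size (L i))

-- Colour the path from v₁ on, keeping track of the colours that some L-colouring of
-- v₁ … vᵢ can give to vᵢ.  Call a colour e bridging from a set U to a set D when ue and
-- ed are edges of DSG(K₆, M) with the signs of the next two edges of the path.  A direct
-- check shows that there are at least three bridging colours from a paired 3-set
-- {c, c', x} to any two apart colours, and from a one-sided 4-set {t₁, t₁', t₂, t₂'} to
-- any single colour; three colours must meet the list of the even vertex in between,
-- which has at least 10 of the 12 colours.  So if the reachable colours at vᵢ contain a
-- paired 3-set, at most one pair of the neighbored 5-set in L(vᵢ₊₂) is unreachable and a
-- reachable paired 3-set remains; if they contain a one-sided 4-set, all of L(vᵢ₊₂) is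
-- reachable.  On the last edge, every paired 3-set and every one-sided 4-set are joined
-- by an edge of either sign.
module Submission where

open import Defs
open import Data.Nat using (ℕ; _≤_; _*_)
open import Data.Product using (_×_)
open import Data.Sum using (_⊎_)

open import Data.Nat using (zero; suc; _+_; _∸_; _<_; _%_; z≤n; s≤s)
open import Data.Nat.Properties
  using (_≤?_; ≤-refl; ≤-reflexive; ≤-trans; <⇒≤; <-trans; n≤1+n; n<1+n; n≮n; m≤n⇒m≤1+n;
         m≤n⇒m<n∨m≡n; +-suc; +-mono-≤; +-monoʳ-≤; +-cancelˡ-≤; +-cancelʳ-≤; *-comm; *-suc;
         *-distribˡ-+; *-monoʳ-≤; ∸-monoˡ-≤; module ≤-Reasoning)
open import Data.Nat.DivMod using ([m+kn]%n≡m%n)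
open import Data.Bool using (Bool; true; false; _∧_; not)
open import Data.Bool.Properties using (∧-conicalˡ; ∧-conicalʳ; not-involutive)
open import Data.Fin using (Fin; zero; suc)
open import Data.Fin.Properties using (_≟_; ∀-cons)
open import Data.Product using (∃; _,_; proj₁; proj₂; uncurry)
open import Data.Product.Properties using (≡-dec)
open import Data.Sum using (inj₁; inj₂; [_,_]; map₂)
open import Data.List using (List; []; _∷_; length)
open import Data.List.Relation.Unary.All as All using (All; []; _∷_)
open import Data.List.Relation.Unary.Any as Any using (Any; here; there; any?)
open import Data.List.Relation.Unary.Any.Properties using (singleton⁻)
open import Function using (_∘_)
open import Relation.Binary.Definitions using (DecidableEquality)
open import Relation.Binary.PropositionalEquality using (_≡_; _≢_; refl; sym; trans; cong; subst; subst₂)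
open import Relation.Nullary using (Dec; yes; no; does; ¬?; _×-dec_; _→-dec_; map′; contradiction)
open import Relation.Nullary.Decidable using (toWitness; isYes≗does)

dec-true⁻¹ : {A : Set} (a? : Dec A) → does a? ≡ true → A
dec-true⁻¹ (yes a) _ = a

==Sg-sound : ∀ {a b} → (a ==Sg b) ≡ true → a ≡ b
==Sg-sound {⊕} {⊕} _ = refl
==Sg-sound {⊖} {⊖} _ = refl

negSg-≢ : ∀ a → negSg a ≢ a
negSg-≢ ⊕ ()
negSg-≢ ⊖ ()

_≟Sg_ : DecidableEquality Sg
⊕ ≟Sg ⊕ = yes refl
⊕ ≟Sg ⊖ = no λ ()
⊖ ≟Sg ⊕ = no λ ()
⊖ ≟Sg ⊖ = yes refl

_≟C_ : DecidableEquality C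
_≟C_ = ≡-dec _≟_ _≟Sg_

∀Sg? : {P : Sg → Set} → (∀ a → Dec (P a)) → Dec (∀ a → P a)
∀Sg? P? = map′ (λ { (p , q) ⊕ → p ; (p , q) ⊖ → q }) (λ f → f ⊕ , f ⊖) (P? ⊕ ×-dec P? ⊖)

∀Fin? : ∀ {n} {P : Fin n → Set} → (∀ i → Dec (P i)) → Dec (∀ i → P i)
∀Fin? {zero}  P? = yes λ ()
∀Fin? {suc n} P? = map′ (uncurry ∀-cons) (λ f → f zero , f ∘ suc) (P? zero ×-dec ∀Fin? (P? ∘ suc))

∀C? : {P : C → Set} → (∀ c → Dec (P c)) → Dec (∀ c → P c)
∀C? P? = map′ (λ f c → f (idx c) (sgn c)) (λ f i a → f (i , a)) (∀Fin? λ i → ∀Sg? λ a → P? (i , a))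

countL-witness : ∀ (p : C → Bool) xs → 1 ≤ countL p xs → ∃ λ c → p c ≡ true
countL-witness p (x ∷ xs) h with p x in px
... | true  = x , px
... | false = countL-witness p xs h

countL-mono : ∀ {p q : C → Bool} xs → (∀ c → p c ≡ true → q c ≡ true) → countL p xs ≤ countL q xs
countL-mono [] p⊆q = z≤n
countL-mono {p} {q} (x ∷ xs) p⊆q with p x in px | q x in qx
... | true  | true  = s≤s (countL-mono xs p⊆q)
... | true  | false = contradiction (trans (sym (p⊆q x px)) qx) λ ()
... | false | true  = m≤n⇒m≤1+n (countL-mono xs p⊆q)
... | false | false = countL-mono xs p⊆q

countL-split : ∀ (p q : C → Bool) xs →
  countL p xs ≡ countL (λ c → p c ∧ q c) xs + countL (λ c → p c ∧ not (q c)) xs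
countL-split p q [] = refl
countL-split p q (x ∷ xs) with p x | q x
... | true  | true  = cong suc (countL-split p q xs)
... | true  | false = trans (cong suc (countL-split p q xs)) (sym (+-suc _ _))
... | false | _     = countL-split p q xs

countL-overlap : ∀ (p q : C → Bool) xs →
  countL p xs + countL q xs ≤ length xs + countL (λ c → p c ∧ q c) xs
countL-overlap p q [] = z≤n
countL-overlap p q (x ∷ xs) with p x | q x
... | true  | true  = s≤s (subst₂ _≤_ (sym (+-suc (countL p xs) _)) (sym (+-suc (length xs) _))
                        (s≤s (countL-overlap p q xs)))
... | true  | false = s≤s (countL-overlap p q xs)
... | false | true  = subst (_≤ suc (length xs + countL (λ c → p c ∧ q c) xs)) (sym (+-suc (countL p xs) _))
                        (s≤s (countL-overlap p q xs))
... | false | false = m≤n⇒m≤1+n (countL-overlap p q xs)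

count-meet : ∀ (p q : C → Bool) → 12 < count p + count q → ∃ λ c → p c ≡ true × q c ≡ true
count-meet p q h with countL-witness _ allC (+-cancelˡ-≤ 12 1 _ (≤-trans h (countL-overlap p q allC)))
... | c , pq = c , ∧-conicalˡ _ _ pq , ∧-conicalʳ _ _ pq

count-∧-≥ : ∀ (p q : C → Bool) {m k} → m + k ≤ count p →
  count (λ c → p c ∧ not (q c)) ≤ k → m ≤ count (λ c → p c ∧ q c)
count-∧-≥ p q {m} {k} big few = +-cancelʳ-≤ k m _
  (≤-trans big (≤-trans (≤-reflexive (countL-split p q allC)) (+-monoʳ-≤ _ few)))

layer-pairC : ∀ c → layer (pairC c) ≡ layer c
layer-pairC (zero , _)                               = refl
layer-pairC (suc zero , _)                           = refl
layer-pairC (suc (suc zero) , _)                     = refl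
layer-pairC (suc (suc (suc zero)) , _)               = refl
layer-pairC (suc (suc (suc (suc zero))) , _)         = refl
layer-pairC (suc (suc (suc (suc (suc zero)))) , _)  = refl

Apart : C → C → Set
Apart c d = d ≢ c × d ≢ pairC c

apart? : ∀ c d → Dec (Apart c d)
apart? c d = ¬? (d ≟C c) ×-dec ¬? (d ≟C pairC c)

apart-of-sgn : ∀ {c d} → sgn d ≢ sgn c → Apart c d
apart-of-sgn d≉c = (λ { refl → d≉c refl }) , (λ { refl → d≉c refl })

apart-of-layer : ∀ {c d} → layer d ≢ layer c → Apart c d
apart-of-layer {c} d≉c = (λ { refl → d≉c refl }) , (λ { refl → d≉c (layer-pairC c) })

SameSideOtherLayer : C → C → Set
SameSideOtherLayer t₁ t₂ = sgn t₂ ≡ sgn t₁ × layer t₂ ≢ layer t₁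

sameSideOtherLayer? : ∀ t₁ t₂ → Dec (SameSideOtherLayer t₁ t₂)
sameSideOtherLayer? t₁ t₂ = (sgn t₂ ≟Sg sgn t₁) ×-dec ¬? (layer t₂ ≟ layer t₁)

triple : C → C → List C
triple c x = c ∷ pairC c ∷ x ∷ []

twoPairs : C → C → List C
twoPairs t₁ t₂ = t₁ ∷ pairC t₁ ∷ t₂ ∷ pairC t₂ ∷ []

record PairedTriple (P : C → Set) : Set where
  field
    c x     : C
    apart   : Apart c x
    members : All P (triple c x)

record TwoPairs (P : C → Set) : Set where
  field
    t₁ t₂   : C
    aligned : SameSideOtherLayer t₁ t₂
    members : All P (twoPairs t₁ t₂)

record NeighboredFive (P : C → Set) : Set where
  field
    a₁ a₂ y  : C
    aligned  : SameSideOtherLayer a₁ a₂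
    opposite : sgn y ≢ sgn a₁
    members  : All P (a₁ ∷ pairC a₁ ∷ a₂ ∷ pairC a₂ ∷ y ∷ [])

mapPairedTriple : ∀ {P Q : C → Set} → (∀ {c} → P c → Q c) → PairedTriple P → PairedTriple Q
mapPairedTriple f t = record { PairedTriple t ; members = All.map f (PairedTriple.members t) }

mapTwoPairs : ∀ {P Q : C → Set} → (∀ {c} → P c → Q c) → TwoPairs P → TwoPairs Q
mapTwoPairs f t = record { TwoPairs t ; members = All.map f (TwoPairs.members t) }

twoPairs-of-neighboredFive : ∀ {P} → NeighboredFive P → TwoPairs P
twoPairs-of-neighboredFive record { aligned = aligned ; members = m₁ ∷ m₁' ∷ m₂ ∷ m₂' ∷ _ } =
  record { aligned = aligned ; members = m₁ ∷ m₁' ∷ m₂ ∷ m₂' ∷ [] }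

-- If no two apart colours of the five both fail R, the failures lie in one pair {a, a'},
-- and the remaining colours still contain a paired triple.
pairedTriple-of-cover : ∀ {P R : C → Set} → NeighboredFive P →
  (∀ {d e} → P d → P e → Apart d e → R d ⊎ R e) → PairedTriple R
pairedTriple-of-cover {R = R}
  record { a₁ = a₁ ; a₂ = a₂ ; y = y ; aligned = a₂≈a₁ , a₂≉a₁ ; opposite = y≉a₁
         ; members = p₁ ∷ p₁' ∷ p₂ ∷ p₂' ∷ py ∷ [] } cover =
  [ from-a₁ , from-a₂ ] (cover p₁ p₂ a₁∣a₂)
  where
  a₁' = pairC a₁
  a₂' = pairC a₂
  a₁∣a₂ : Apart a₁ a₂
  a₁∣a₂ = apart-of-layer a₂≉a₁
  a₁∣a₂' : Apart a₁ a₂'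
  a₁∣a₂' = apart-of-layer (a₂≉a₁ ∘ trans (sym (layer-pairC a₂)))
  a₁'∣a₂ : Apart a₁' a₂
  a₁'∣a₂ = apart-of-layer (a₂≉a₁ ∘ λ e → trans e (layer-pairC a₁))
  a₁'∣a₂' : Apart a₁' a₂'
  a₁'∣a₂' = apart-of-layer (a₂≉a₁ ∘ λ e → trans (sym (layer-pairC a₂)) (trans e (layer-pairC a₁)))
  a₁∣y : Apart a₁ y
  a₁∣y = apart-of-sgn y≉a₁
  a₁'∣y : Apart a₁' y
  a₁'∣y = apart-of-sgn y≉a₁
  a₂∣y : Apart a₂ y
  a₂∣y = apart-of-sgn (y≉a₁ ∘ λ e → trans e a₂≈a₁)
  triple-of : ∀ {c x} → Apart c x → R c → R (pairC c) → R x → PairedTriple R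
  triple-of c∣x rc rc' rx = record { apart = c∣x ; members = rc ∷ rc' ∷ rx ∷ [] }
  from-a₁a₁' : R a₁ → R a₁' → PairedTriple R
  from-a₁a₁' r₁ r₁' = [ triple-of a₁∣a₂ r₁ r₁' , triple-of a₁∣y r₁ r₁' ] (cover p₂ py a₂∣y)
  from-a₁y : R a₁ → R y → PairedTriple R
  from-a₁y r₁ ry = [ from-a₁a₁' r₁ , (λ r₂ → [ from-a₁a₁' r₁ , (λ r₂' → triple-of a₂∣y r₂ r₂' ry) ]
    (cover p₁' p₂' a₁'∣a₂')) ] (cover p₁' p₂ a₁'∣a₂)
  from-a₁ : R a₁ → PairedTriple R
  from-a₁ r₁ = [ from-a₁a₁' r₁ , from-a₁y r₁ ] (cover p₁' py a₁'∣y)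
  from-a₂a₂' : R a₂ → R a₂' → PairedTriple R
  from-a₂a₂' r₂ r₂' = [ from-a₁ , triple-of a₂∣y r₂ r₂' ] (cover p₁ py a₁∣y)
  from-a₂ : R a₂ → PairedTriple R
  from-a₂ r₂ = [ from-a₁ , from-a₂a₂' r₂ ] (cover p₁ p₂' a₁∣a₂')

pairedIn : CSet → C → Bool
pairedIn S c = S c ∧ S (pairC c)

pairs-of-Paired : ∀ {S m} → Paired S → m + 1 ≤ size S → m ≤ count (pairedIn S)
pairs-of-Paired {S} paired big = count-∧-≥ S (S ∘ pairC) big paired

non-apart-count : ∀ c → count (λ d → not (does (apart? c d))) ≤ 2
non-apart-count = toWitness {a? = ∀C? λ c → count (λ d → not (does (apart? c d))) ≤? 2} _

apart-in : ∀ {S} → 3 ≤ size S → ∀ c → ∃ λ x → x ∈C S × Apart c x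
apart-in {S} three c
  with countL-witness (λ d → S d ∧ does (apart? c d)) allC
         (count-∧-≥ S (does ∘ apart? c) {1} three (≤-trans (countL-mono allC outside) (non-apart-count c)))
  where
  outside : ∀ d → S d ∧ not (does (apart? c d)) ≡ true → not (does (apart? c d)) ≡ true
  outside d = ∧-conicalʳ (S d) _
... | x , x∈∣ = x , ∧-conicalˡ _ _ x∈∣ , dec-true⁻¹ (apart? c x) (∧-conicalʳ (S x) _ x∈∣)

other-layer : ∀ {S} (p : C → Bool) → Layered S → (∀ c → p c ≡ true → c ∈C S) →
  3 ≤ count p → ∀ l → ∃ λ c → p c ≡ true × layer c ≢ l
other-layer {S} p (_ , ≤2-per-layer) p⊆S three l
  with countL-witness _ allC (count-∧-≥ p (does ∘ ¬? ∘ (_≟ l) ∘ layer) {1} three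
         (≤-trans (countL-mono allC in-layer) (≤2-per-layer l)))
  where
  in-layer : ∀ c → p c ∧ not (does (¬? (layer c ≟ l))) ≡ true → S c ∧ (layer c ==F3 l) ≡ true
  in-layer c h rewrite p⊆S c (∧-conicalˡ _ _ h) | isYes≗does (layer c ≟ l) =
    trans (sym (not-involutive _)) (∧-conicalʳ _ _ h)
... | c , pc∉l = c , ∧-conicalˡ _ _ pc∉l , dec-true⁻¹ (¬? (layer c ≟ l)) (∧-conicalʳ _ _ pc∉l)

pairedTriple-of-PairedSet3 : ∀ {S} → PairedSet 3 S → PairedTriple (_∈C S)
pairedTriple-of-PairedSet3 {S} (paired , size≡3)
  with countL-witness (pairedIn S) allC (≤-trans (s≤s z≤n) (pairs-of-Paired {S} {2} paired three))
  where
  three : 3 ≤ size S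
  three = ≤-reflexive (sym size≡3)
... | c , cc'∈ with apart-in (≤-reflexive (sym size≡3)) c
... | x , x∈ , c∣x =
  record { apart = c∣x ; members = ∧-conicalˡ _ _ cc'∈ ∷ ∧-conicalʳ _ _ cc'∈ ∷ x∈ ∷ [] }

twoPairs-of-OneSided4 : ∀ {S} → OneSided 4 S → TwoPairs (_∈C S)
twoPairs-of-OneSided4 {S} (layered@(paired , _) , size≡4 , _ , one-sided)
  with pairs-of-Paired {S} {3} paired (≤-reflexive (sym size≡4))
... | three with countL-witness (pairedIn S) allC (≤-trans (s≤s z≤n) three)
... | t₁ , t₁t₁'∈ with other-layer {S} (pairedIn S) layered (λ c → ∧-conicalˡ _ _) three (layer t₁)
... | t₂ , t₂t₂'∈ , t₂≉t₁ = record
  { aligned = trans (one-sided t₂ t₂∈) (sym (one-sided t₁ t₁∈)) , t₂≉t₁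
  ; members = t₁∈ ∷ ∧-conicalʳ _ _ t₁t₁'∈ ∷ t₂∈ ∷ ∧-conicalʳ _ _ t₂t₂'∈ ∷ [] }
  where
  t₁∈ = ∧-conicalˡ _ _ t₁t₁'∈
  t₂∈ = ∧-conicalˡ _ _ t₂t₂'∈

onSide : CSet → Sg → C → Bool
onSide T b c = T c ∧ (sgn c ==Sg b)

neighboredFive-of-ContainsNeighbored : ∀ {S} → ContainsNeighbored S → NeighboredFive (_∈C S)
neighboredFive-of-ContainsNeighbored (T , T⊆S , (layered , _ , a , four , one , closed))
  with countL-witness (onSide T a) allC (≤-trans (s≤s z≤n) (≤-reflexive (sym four)))
... | a₁ , a₁∈a with other-layer {T} (onSide T a) layered (λ c → ∧-conicalˡ _ _) three (layer a₁)
  where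
  three : 3 ≤ count (onSide T a)
  three = ≤-trans (n≤1+n 3) (≤-reflexive (sym four))
... | a₂ , a₂∈a , a₂≉a₁ with countL-witness (onSide T (negSg a)) allC (≤-reflexive (sym one))
... | y , y∈-a = record
  { aligned  = trans (side a₂∈a) (sym (side a₁∈a)) , a₂≉a₁
  ; opposite = λ y≈a₁ → negSg-≢ a (trans (sym (side y∈-a)) (trans y≈a₁ (side a₁∈a)))
  ; members  = T⊆S _ a₁∈ ∷ T⊆S _ (closed _ a₁∈ (side a₁∈a)) ∷ T⊆S _ a₂∈
             ∷ T⊆S _ (closed _ a₂∈ (side a₂∈a)) ∷ T⊆S _ (∧-conicalˡ _ _ y∈-a) ∷ [] }
  where
  side : ∀ {c b} → onSide T b c ≡ true → sgn c ≡ b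
  side h = ==Sg-sound (∧-conicalʳ _ _ h)
  a₁∈ = ∧-conicalˡ _ _ a₁∈a
  a₂∈ = ∧-conicalˡ _ _ a₂∈a

record Reachable (σ : ℕ → Sg) (L : ℕ → CSet) (i : ℕ) (c : C) : Set where
  constructor reached
  field
    φ         : ℕ → C
    colouring : IsLColoring i σ L φ
    ends-in   : φ i ≡ c

colorable-of-reachable : ∀ {σ L n c} → Reachable σ L n c → LColorable n σ L
colorable-of-reachable (reached φ colouring _) = φ , colouring

reachable-start : ∀ {σ L c} → c ∈C L 1 → Reachable σ L 1 c
reachable-start {c = c} c∈ =
  reached (λ _ → c) ((λ { _ (s≤s z≤n) (s≤s z≤n) → c∈ }) , λ { _ (s≤s z≤n) (s≤s ()) }) refl

extend : (ℕ → C) → ℕ → C → ℕ → C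
extend φ i d j with j ≤? i
... | yes _ = φ j
... | no  _ = d

extend-old : ∀ φ {i} d {j} → j ≤ i → extend φ i d j ≡ φ j
extend-old φ {i} d {j} j≤i with j ≤? i
... | yes _   = refl
... | no j≰i = contradiction j≤i j≰i

extend-new : ∀ φ i d → extend φ i d (suc i) ≡ d
extend-new φ i d with suc i ≤? i
... | yes i<i = contradiction i<i (n≮n i)
... | no  _   = refl

SignedEdge : Sg → C → C → Set
SignedEdge s c d = Adjacent c d × mstar c d ≡ s

signedEdge? : ∀ s c d → Dec (SignedEdge s c d)
signedEdge? s c d = ¬? (idx c ≟ idx d) ×-dec (mstar c d ≟Sg s)

reachable-step : ∀ {σ L i c d} → Reachable σ L i c → d ∈C L (suc i) → SignedEdge (σ i) c d →
  Reachable σ L (suc i) d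
reachable-step {σ} {L} {i} {c} {d} (reached φ (colours , edges) φi≡c) d∈ c─d =
  reached (extend φ i d) (colours′ , edges′) (extend-new φ i d)
  where
  colours′ : ∀ j → 1 ≤ j → j ≤ suc i → extend φ i d j ∈C L j
  colours′ j 1≤j j≤1+i with m≤n⇒m<n∨m≡n j≤1+i
  ... | inj₁ (s≤s j≤i) rewrite extend-old φ d j≤i = colours j 1≤j j≤i
  ... | inj₂ refl      rewrite extend-new φ i d   = d∈
  edges′ : ∀ j → 1 ≤ j → j < suc i → SignedEdge (σ j) (extend φ i d j) (extend φ i d (suc j))
  edges′ j 1≤j (s≤s j≤i) with m≤n⇒m<n∨m≡n j≤i
  ... | inj₁ j<i rewrite extend-old φ d (<⇒≤ j<i) | extend-old φ d j<i = edges j 1≤j j<i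
  ... | inj₂ refl rewrite extend-old φ d (≤-refl {j}) | extend-new φ j d | φi≡c = c─d

Bridge : Sg → Sg → List C → List C → C → Set
Bridge s₁ s₂ U D e = Any (λ u → SignedEdge s₁ u e) U × Any (SignedEdge s₂ e) D

bridge? : ∀ s₁ s₂ U D e → Dec (Bridge s₁ s₂ U D e)
bridge? s₁ s₂ U D e = any? (λ u → signedEdge? s₁ u e) U ×-dec any? (signedEdge? s₂ e) D

bridges : Sg → Sg → List C → List C → ℕ
bridges s₁ s₂ U D = count (does ∘ bridge? s₁ s₂ U D)

Joined : Sg → List C → List C → Set
Joined s U T = Any (λ u → Any (SignedEdge s u) T) U

joined? : ∀ s U T → Dec (Joined s U T)
joined? s U T = any? (λ u → any? (signedEdge? s u) T) U

reachable-across : ∀ {σ L i U D} → All (Reachable σ L i) U → 10 ≤ size (L (suc i)) →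
  3 ≤ bridges (σ i) (σ (suc i)) U D → All (_∈C L (2 + i)) D → Any (Reachable σ L (2 + i)) D
reachable-across {σ} {L} {i} {U} {D} reach-U big many D∈
  with count-meet (does ∘ bridge? (σ i) (σ (suc i)) U D) (L (suc i)) (+-mono-≤ many big)
... | e , is-bridge , e∈ with dec-true⁻¹ (bridge? (σ i) (σ (suc i)) U D e) is-bridge
... | U─e , e─D = onward D∈ e─D
  where
  reach-e : Reachable σ L (suc i) e
  reach-e = All.lookupWith {R = λ _ → Reachable σ L (suc i) e}
              (λ reach-u u─e → reachable-step reach-u e∈ u─e) reach-U U─e
  onward : ∀ {D} → All (_∈C L (2 + i)) D → Any (SignedEdge (σ (suc i)) e) D →
    Any (Reachable σ L (2 + i)) D
  onward (d∈ ∷ _)  (here e─d)  = here (reachable-step reach-e d∈ e─d)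
  onward (_ ∷ D∈) (there e─D) = there (onward D∈ e─D)

colorable-of-joined : ∀ {σ L i U T} → All (Reachable σ L i) U → All (_∈C L (suc i)) T →
  Joined (σ i) U T → LColorable (suc i) σ L
colorable-of-joined {σ} {L} {i} reach-U T∈ =
  All.lookupWith {R = λ _ → LColorable (suc i) σ L}
    (λ reach-u u─T → All.lookupWith {R = λ _ → LColorable (suc i) σ L}
      (λ t∈ u─t → colorable-of-reachable (reachable-step reach-u t∈ u─t)) T∈ u─T) reach-U

bridges-triple : ∀ c x → Apart c x → ∀ d₁ d₂ → Apart d₁ d₂ → ∀ s₁ s₂ →
  3 ≤ bridges s₁ s₂ (triple c x) (d₁ ∷ d₂ ∷ [])
bridges-triple = toWitness {a? =
  ∀C? λ c → ∀C? λ x → apart? c x →-dec ∀C? λ d₁ → ∀C? λ d₂ → apart? d₁ d₂ →-dec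
  ∀Sg? λ s₁ → ∀Sg? λ s₂ → 3 ≤? bridges s₁ s₂ (triple c x) (d₁ ∷ d₂ ∷ [])} _

bridges-twoPairs : ∀ t₁ t₂ → SameSideOtherLayer t₁ t₂ → ∀ d s₁ s₂ →
  3 ≤ bridges s₁ s₂ (twoPairs t₁ t₂) (d ∷ [])
bridges-twoPairs = toWitness {a? =
  ∀C? λ t₁ → ∀C? λ t₂ → sameSideOtherLayer? t₁ t₂ →-dec
  ∀C? λ d → ∀Sg? λ s₁ → ∀Sg? λ s₂ → 3 ≤? bridges s₁ s₂ (twoPairs t₁ t₂) (d ∷ [])} _

joined-triple-twoPairs : ∀ c x → Apart c x → ∀ t₁ t₂ → SameSideOtherLayer t₁ t₂ → ∀ s →
  Joined s (triple c x) (twoPairs t₁ t₂)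
joined-triple-twoPairs = toWitness {a? =
  ∀C? λ c → ∀C? λ x → apart? c x →-dec ∀C? λ t₁ → ∀C? λ t₂ → sameSideOtherLayer? t₁ t₂ →-dec
  ∀Sg? λ s → joined? s (triple c x) (twoPairs t₁ t₂)} _

joined-twoPairs-triple : ∀ t₁ t₂ → SameSideOtherLayer t₁ t₂ → ∀ c x → Apart c x → ∀ s →
  Joined s (twoPairs t₁ t₂) (triple c x)
joined-twoPairs-triple = toWitness {a? =
  ∀C? λ t₁ → ∀C? λ t₂ → sameSideOtherLayer? t₁ t₂ →-dec ∀C? λ c → ∀C? λ x → apart? c x →-dec
  ∀Sg? λ s → joined? s (twoPairs t₁ t₂) (triple c x)} _

pairedTriple-step : ∀ {σ L} i → 10 ≤ size (L (suc i)) → ContainsNeighbored (L (2 + i)) →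
  PairedTriple (Reachable σ L i) → PairedTriple (Reachable σ L (2 + i))
pairedTriple-step {σ} i big nb record { c = c ; x = x ; apart = c∣x ; members = reach } =
  pairedTriple-of-cover (neighboredFive-of-ContainsNeighbored nb) λ {d} {e} d∈ e∈ d∣e →
    map₂ singleton⁻ (Any.toSum (reachable-across reach big
      (bridges-triple c x c∣x d e d∣e (σ i) (σ (suc i))) (d∈ ∷ e∈ ∷ [])))

twoPairs-step : ∀ {σ L} i → 10 ≤ size (L (suc i)) → ContainsNeighbored (L (2 + i)) →
  TwoPairs (Reachable σ L i) → TwoPairs (Reachable σ L (2 + i))
twoPairs-step {σ} i big nb record { t₁ = t₁ ; t₂ = t₂ ; aligned = aligned ; members = reach } =
  mapTwoPairs (λ {d} d∈ → singleton⁻ (reachable-across reach big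
                 (bridges-twoPairs t₁ t₂ aligned d (σ i) (σ (suc i))) (d∈ ∷ [])))
    (twoPairs-of-neighboredFive (neighboredFive-of-ContainsNeighbored nb))

colorable-of-pairedTriple : ∀ {σ L i} → PairedTriple (Reachable σ L i) → TwoPairs (_∈C L (suc i)) →
  LColorable (suc i) σ L
colorable-of-pairedTriple {σ} {i = i}
  record { c = c ; x = x ; apart = c∣x ; members = reach }
  record { t₁ = t₁ ; t₂ = t₂ ; aligned = aligned ; members = T∈ } =
  colorable-of-joined reach T∈ (joined-triple-twoPairs c x c∣x t₁ t₂ aligned (σ i))

colorable-of-twoPairs : ∀ {σ L i} → TwoPairs (Reachable σ L i) → PairedTriple (_∈C L (suc i)) →
  LColorable (suc i) σ L
colorable-of-twoPairs {σ} {i = i}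
  record { t₁ = t₁ ; t₂ = t₂ ; aligned = aligned ; members = reach }
  record { c = c ; x = x ; apart = c∣x ; members = T∈ } =
  colorable-of-joined reach T∈ (joined-twoPairs-triple t₁ t₂ aligned c x c∣x (σ i))

odd-bound : ∀ {j k} → suc j < k → 3 + 2 * j ≤ 2 * k ∸ 1
odd-bound {j} {k} 2+j≤k = begin
  3 + 2 * j          ≡⟨ cong (_∸ 1) (*-distribˡ-+ 2 2 j) ⟨
  2 * (2 + j) ∸ 1    ≤⟨ ∸-monoˡ-≤ 1 (*-monoʳ-≤ 2 2+j≤k) ⟩
  2 * k ∸ 1          ∎
  where open ≤-Reasoning

innerCond-at : ∀ {k L j} → InnerCond k L → suc j < k →
  10 ≤ size (L (2 + 2 * j)) × ContainsNeighbored (L (3 + 2 * j))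
innerCond-at {j = j} inner j+1<k =
  proj₂ (inner (2 + 2 * j) (s≤s (s≤s z≤n)) (≤-trans (n≤1+n _) (odd-bound j+1<k)))
    (trans (cong (λ n → (2 + n) % 2) (*-comm 2 j)) ([m+kn]%n≡m%n 2 j 2)) ,
  proj₁ (inner (3 + 2 * j) (s≤s (s≤s z≤n)) (odd-bound j+1<k))
    (trans (cong (λ n → (3 + n) % 2) (*-comm 2 j)) ([m+kn]%n≡m%n 3 j 2))

along-odd-vertices : ∀ {k L} (I : ℕ → Set) → InnerCond k L → I 1 →
  (∀ i → 10 ≤ size (L (suc i)) → ContainsNeighbored (L (2 + i)) → I i → I (2 + i)) →
  ∀ j → j < k → I (1 + 2 * j)
along-odd-vertices I inner start step zero    _     = start
along-odd-vertices I inner start step (suc j) j+1<k =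
  subst I (cong suc (sym (*-suc 2 j)))
    (uncurry (step (1 + 2 * j)) (innerCond-at inner j+1<k)
      (along-odd-vertices I inner start step j (<-trans (n<1+n j) j+1<k)))

lemma4p8 : (k : ℕ) → 1 ≤ k → (σ : ℕ → Sg) → (L : ℕ → CSet) →
    ((PairedSet 3 (L 1) × OneSided 4 (L (2 * k)) × InnerCond k L)
      ⊎ (OneSided 4 (L 1) × PairedSet 3 (L (2 * k)) × InnerCond k L)) →
    LColorable (2 * k) σ L
lemma4p8 (suc k) _ σ L (inj₁ (first , last , inner)) =
  subst (λ n → LColorable n σ L) (sym (*-suc 2 k))
    (colorable-of-pairedTriple
      (along-odd-vertices (PairedTriple ∘ Reachable σ L) inner
        (mapPairedTriple reachable-start (pairedTriple-of-PairedSet3 first)) pairedTriple-step k ≤-refl)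
      (twoPairs-of-OneSided4 (subst (OneSided 4 ∘ L) (*-suc 2 k) last)))
lemma4p8 (suc k) _ σ L (inj₂ (first , last , inner)) =
  subst (λ n → LColorable n σ L) (sym (*-suc 2 k))
    (colorable-of-twoPairs
      (along-odd-vertices (TwoPairs ∘ Reachable σ L) inner
        (mapTwoPairs reachable-start (twoPairs-of-OneSided4 first)) twoPairs-step k ≤-refl)
      (pairedTriple-of-PairedSet3 (subst (PairedSet 3 ∘ L) (*-suc 2 k) last)))
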